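{- Let $G$ be a finite simple connected graph and $\sigma$ a position of the parallel chip-firing game on $G$ with period $p(\sigma)>1$. Then for all sufficiently large $t$, $U^t\sigma(v)\le 2\deg(v)-1$ for every vertex $v$ of $G$.
   Context: Parallel chip-firing game on a finite simple connected graph $G$: a position $\sigma$ assigns a nonnegative integer $\sigma(v)$ (chips) to each vertex $v$. At each step every vertex $v$ with $\sigma(v)\ge\deg(v)$ simultaneously sends one chip to each neighbor; others do not fire. $U$ denotes the step operator, $U^0\sigma=\sigma$, $U^m\sigma=U(U^{m-1}\sigma)$. The period $p(\sigma)$ is the least positive integer $p$ such that $U^t\sigma=U^{t+p}\sigma$ for all sufficiently large $t$. -}

module Defs where

open import Data.Nat using (ℕ; zero; suc; _+_; _∸_; _≤_; _<_; _≥_; _≤ᵇ_)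
open import Data.Nat.Properties using ()
open import Data.Fin using (Fin)
open import Data.Bool using (Bool; true; false; if_then_else_; _∧_)
open import Data.List using (List; length; filter; map; sum)
open import Data.List using (allFin)
open import Data.Product using (_×_; Σ; ∃; _,_)
open import Relation.Binary.PropositionalEquality using (_≡_)
open import Relation.Nullary using (¬_)
open import Data.Bool.Properties using (T?)
open import Data.Bool using (T)

record Graph (n : ℕ) : Set where
  field
    adj      : Fin n → Fin n → Bool
    adj-sym  : ∀ u v → adj u v ≡ adj v u
    adj-irr  : ∀ v → adj v v ≡ false

open Graph public

data Reach {n : ℕ} (G : Graph n) : Fin n → Fin n → Set where
  here : ∀ {v} → Reach G v v
  step : ∀ {u v w} → T (adj G u v) → Reach G v w → Reach G u w

Connected : ∀ {n} → Graph n → Set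
Connected G = ∀ u v → Reach G u v

neighbours : ∀ {n} → Graph n → Fin n → List (Fin n)
neighbours G v = filter (λ u → T? (adj G v u)) (allFin _)

deg : ∀ {n} → Graph n → Fin n → ℕ
deg G v = length (neighbours G v)

-- Positions: number of chips on each vertex.
Position : ℕ → Set
Position n = Fin n → ℕ

fires : ∀ {n} → Graph n → Position n → Fin n → Bool
fires G σ v = deg G v ≤ᵇ σ v

U : ∀ {n} → Graph n → Position n → Position n
U G σ v =
  (σ v ∸ (if fires G σ v then deg G v else 0))
  + length (filter (λ u → T? (fires G σ u)) (neighbours G v))

U^ : ∀ {n} → Graph n → ℕ → Position n → Position n
U^ G zero    σ = σ
U^ G (suc m) σ = U G (U^ G m σ)

IsEventualPeriod : ∀ {n} → Graph n → Position n → ℕ → Set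
IsEventualPeriod G σ p =
  ∃ λ T₀ → ∀ t → T₀ ≤ t → ∀ v → U^ G t σ v ≡ U^ G (t + p) σ v

Period : ∀ {n} → Graph n → Position n → ℕ → Set
Period G σ p =
  (0 < p) × IsEventualPeriod G σ p
  × (∀ q → 0 < q → IsEventualPeriod G σ q → p ≤ q)

-- Call a vertex v LARGE in τ when τ(v) ≥ 2·deg(v).  The argument is:
--  (1) Large vertices fire, and largeness propagates backwards in time: a
--      silent vertex holds < deg(v) chips and receives ≤ deg(v), so it cannot
--      become large, while a firing vertex never gains chips.
--  (2) In the periodic regime (from time T₀ on, with period p ≥ 1), a vertex
--      that is large at one time t ≥ T₀ is large at every later multiple
--      t + s·p, hence, going backwards, at every time s ≥ T₀: it always fires.
--  (3) An always-firing vertex has a nonincreasing, periodic chip count, which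
--      is therefore constant; so it receives deg(v) chips each step, i.e. all
--      of its neighbours always fire too.  By connectivity every vertex always
--      fires, every step is then the identity, and the orbit has period 1.
-- Hence, if p(σ) > 1, no vertex is ever large after T₀, which is the claim.
module Submission where

open import Defs
open import Data.Nat using (ℕ; _+_; _*_; _∸_; _≤_; _<_)
open import Data.Fin using (Fin)
open import Data.Product using (∃)

open import Data.Nat using (zero; suc; z≤n; s≤s; _≤′_; ≤′-refl; ≤′-step; _≤?_; >-nonZero)
open import Data.Nat.Properties
open import Data.Product using (_,_)
open import Data.Bool using (true; false; T)
open import Data.Bool.Properties using (T?)
open import Data.List using (filter; length)
open import Data.List.Properties using (length-filter; filter-all; filter-notAll)
open import Data.List.Membership.Propositional.Properties using (∈-filter⁺; ∈-allFin)
import Data.List.Relation.Unary.Any as Any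
import Data.List.Relation.Unary.All as All
open import Relation.Nullary using (¬_; yes; no; contradiction)
open import Relation.Binary.PropositionalEquality

module _ (f : ℕ → ℕ) where

  backward-closed : (P : ℕ → Set) → (∀ s → P (f (suc s)) → P (f s)) →
                    ∀ {s t} → s ≤ t → P (f t) → P (f s)
  backward-closed P back s≤t = go (≤⇒≤′ s≤t)
    where
      go : ∀ {s t} → s ≤′ t → P (f t) → P (f s)
      go ≤′-refl        Pt = Pt
      go (≤′-step s≤′t) Pt = go s≤′t (back _ Pt)

  antitone-from : ∀ T₀ → (∀ s → T₀ ≤ s → f (suc s) ≤ f s) →
                  ∀ {s t} → T₀ ≤ s → s ≤ t → f t ≤ f s
  antitone-from T₀ decreasing {s} T₀≤s s≤t = go (≤⇒≤′ s≤t)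
    where
      go : ∀ {t} → s ≤′ t → f t ≤ f s
      go ≤′-refl        = ≤-refl
      go (≤′-step s≤′t) =
        ≤-trans (decreasing _ (≤-trans T₀≤s (≤′⇒≤ s≤′t))) (go s≤′t)

periodic-multiple : ∀ {A : Set} (f : ℕ → A) T₀ p →
                    (∀ t → T₀ ≤ t → f t ≡ f (t + p)) →
                    ∀ m t → T₀ ≤ t → f (t + m * p) ≡ f t
periodic-multiple f T₀ p per zero    t T₀≤t = cong f (+-identityʳ t)
periodic-multiple f T₀ p per (suc m) t T₀≤t = begin
  f (t + (p + m * p)) ≡⟨ cong f (+-assoc-comm t p (m * p)) ⟩
  f (t + m * p + p)   ≡⟨ sym (per (t + m * p) (≤-trans T₀≤t (m≤m+n t _))) ⟩
  f (t + m * p)       ≡⟨ periodic-multiple f T₀ p per m t T₀≤t ⟩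
  f t                 ∎
  where
    open ≡-Reasoning
    +-assoc-comm : ∀ a b c → a + (b + c) ≡ a + c + b
    +-assoc-comm a b c = trans (cong (a +_) (+-comm b c)) (sym (+-assoc a c b))

antitone-periodic⇒constant : ∀ (f : ℕ → ℕ) T₀ p → 1 ≤ p →
  (∀ s → T₀ ≤ s → f (suc s) ≤ f s) → (∀ t → T₀ ≤ t → f t ≡ f (t + p)) →
  ∀ s → T₀ ≤ s → f (suc s) ≡ f s
antitone-periodic⇒constant f T₀ p 1≤p decreasing per s T₀≤s =
  ≤-antisym (decreasing s T₀≤s) (begin
    f s       ≡⟨ per s T₀≤s ⟩
    f (s + p) ≤⟨ antitone-from f T₀ decreasing (≤-trans T₀≤s (n≤1+n s)) 1+s≤s+p ⟩
    f (suc s) ∎)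
  where
    open ≤-Reasoning
    1+s≤s+p : suc s ≤ s + p
    1+s≤s+p = subst (_≤ s + p) (+-comm s 1) (+-monoʳ-≤ s 1≤p)

module _ {n} (G : Graph n) where

  Fires : Position n → Fin n → Set
  Fires τ v = T (fires G τ v)

  firingNeighbours : Position n → Fin n → ℕ
  firingNeighbours τ v = length (filter (λ u → T? (fires G τ u)) (neighbours G v))

  firingNeighbours≤deg : ∀ τ v → firingNeighbours τ v ≤ deg G v
  firingNeighbours≤deg τ v = length-filter (λ u → T? (fires G τ u)) (neighbours G v)

  Large : Position n → Fin n → Set
  Large τ v = 2 * deg G v ≤ τ v

  fires⇒deg≤ : ∀ τ v → Fires τ v → deg G v ≤ τ v
  fires⇒deg≤ τ v = ≤ᵇ⇒≤ (deg G v) (τ v)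

  silent⇒<deg : ∀ τ v → ¬ Fires τ v → τ v < deg G v
  silent⇒<deg τ v silent = ≰⇒> (λ d≤τv → silent (≤⇒≤ᵇ d≤τv))

  large⇒fires : ∀ τ v → Large τ v → Fires τ v
  large⇒fires τ v large = ≤⇒≤ᵇ (≤-trans (m≤m+n (deg G v) _) large)

  U-firing : ∀ τ v → Fires τ v → U G τ v ≡ τ v ∸ deg G v + firingNeighbours τ v
  U-firing τ v f with fires G τ v
  ... | true = refl

  U-silent : ∀ τ v → ¬ Fires τ v → U G τ v ≡ τ v + firingNeighbours τ v
  U-silent τ v silent with fires G τ v
  ... | true  = contradiction _ silent
  ... | false = refl

  -- A firing vertex loses deg(v) and gains at most deg(v) chips.
  firing-noninc : ∀ τ v → Fires τ v → U G τ v ≤ τ v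
  firing-noninc τ v f = begin
    U G τ v                                 ≡⟨ U-firing τ v f ⟩
    τ v ∸ deg G v + firingNeighbours τ v    ≤⟨ +-monoʳ-≤ (τ v ∸ deg G v) (firingNeighbours≤deg τ v) ⟩
    τ v ∸ deg G v + deg G v                 ≡⟨ m∸n+n≡m (fires⇒deg≤ τ v f) ⟩
    τ v                                     ∎
    where open ≤-Reasoning

  stable⇒neighbours-fire : ∀ τ v u → Fires τ v → U G τ v ≡ τ v →
                           T (adj G v u) → Fires τ u
  stable⇒neighbours-fire τ v u f stable v~u with T? (fires G τ u)
  ... | yes fu = fu
  ... | no silent = contradiction all-received (<⇒≢ some-missed)
    where
      u∈N : Any.Any (u ≡_) (neighbours G v)
      u∈N = ∈-filter⁺ (λ w → T? (adj G v w)) (∈-allFin u) v~u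
      some-missed : firingNeighbours τ v < deg G v
      some-missed = filter-notAll (λ w → T? (fires G τ w)) (neighbours G v)
                      (Any.map (λ { refl → silent }) u∈N)
      all-received : firingNeighbours τ v ≡ deg G v
      all-received = +-cancelˡ-≡ (τ v ∸ deg G v) _ _ (begin
        τ v ∸ deg G v + firingNeighbours τ v ≡⟨ sym (U-firing τ v f) ⟩
        U G τ v                              ≡⟨ stable ⟩
        τ v                                  ≡⟨ sym (m∸n+n≡m (fires⇒deg≤ τ v f)) ⟩
        τ v ∸ deg G v + deg G v              ∎)
        where open ≡-Reasoning

  all-fire⇒fixed : ∀ τ → (∀ w → Fires τ w) → ∀ v → U G τ v ≡ τ v
  all-fire⇒fixed τ allFire v = begin
    U G τ v                              ≡⟨ U-firing τ v (allFire v) ⟩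
    τ v ∸ deg G v + firingNeighbours τ v ≡⟨ cong (λ ns → τ v ∸ deg G v + length ns) received ⟩
    τ v ∸ deg G v + deg G v              ≡⟨ m∸n+n≡m (fires⇒deg≤ τ v (allFire v)) ⟩
    τ v                                  ∎
    where
      open ≡-Reasoning
      received : filter (λ u → T? (fires G τ u)) (neighbours G v) ≡ neighbours G v
      received = filter-all (λ u → T? (fires G τ u)) {neighbours G v} (All.tabulate (λ {u} _ → allFire u))

  -- Largeness is inherited from the next step: a silent vertex cannot become
  -- large, and a firing one does not grow.
  large-preimage : ∀ τ v → Large (U G τ) v → Large τ v
  large-preimage τ v large with T? (fires G τ v)
  ... | yes f = ≤-trans large (firing-noninc τ v f)
  ... | no silent = contradiction large (<⇒≱ (begin-strict
    U G τ v                       ≡⟨ U-silent τ v silent ⟩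
    τ v + firingNeighbours τ v    <⟨ +-mono-<-≤ (silent⇒<deg τ v silent) (firingNeighbours≤deg τ v) ⟩
    deg G v + deg G v             ≡⟨ cong (deg G v +_) (sym (+-identityʳ (deg G v))) ⟩
    2 * deg G v                   ∎))
    where open ≤-Reasoning

  module Orbit (σ : Position n) (T₀ p : ℕ) (1≤p : 1 ≤ p)
               (periodic : ∀ t → T₀ ≤ t → ∀ v → U^ G t σ v ≡ U^ G (t + p) σ v) where

    X : ℕ → Position n
    X s = U^ G s σ

    AlwaysFires : Fin n → Set
    AlwaysFires v = ∀ s → T₀ ≤ s → Fires (X s) v

    large⇒alwaysFires : ∀ t v → T₀ ≤ t → Large (X t) v → AlwaysFires v
    large⇒alwaysFires t v T₀≤t large s T₀≤s =
      large⇒fires (X s) v (backward-closed (λ s → X s v) (λ c → 2 * deg G v ≤ c)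
                              (λ s → large-preimage (X s) v) s≤t+sp large-later)
      where
        s≤t+sp : s ≤ t + s * p
        s≤t+sp = ≤-trans (m≤m*n s p {{>-nonZero 1≤p}}) (m≤n+m (s * p) t)
        large-later : Large (X (t + s * p)) v
        large-later = subst (2 * deg G v ≤_)
          (sym (periodic-multiple (λ s → X s v) T₀ p (λ t le → periodic t le v) s t T₀≤t))
          large

    -- An always-firing vertex has constant chip count, so its neighbours
    -- always fire as well.
    alwaysFires-spreads : ∀ v u → T (adj G v u) → AlwaysFires v → AlwaysFires u
    alwaysFires-spreads v u v~u always s T₀≤s =
      stable⇒neighbours-fire (X s) v u (always s T₀≤s) (constant s T₀≤s) v~u
      where
        constant : ∀ s → T₀ ≤ s → X (suc s) v ≡ X s v
        constant = antitone-periodic⇒constant (λ s → X s v) T₀ p 1≤p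
          (λ s le → firing-noninc (X s) v (always s le)) (λ t le → periodic t le v)

    alwaysFires-reach : ∀ {v w} → Reach G v w → AlwaysFires v → AlwaysFires w
    alwaysFires-reach here             always = always
    alwaysFires-reach (step v~u u⇝w) always =
      alwaysFires-reach u⇝w (alwaysFires-spreads _ _ v~u always)

    everywhere⇒period1 : (∀ w → AlwaysFires w) → IsEventualPeriod G σ 1
    everywhere⇒period1 always = T₀ , λ t T₀≤t w → sym (begin
      X (t + 1) w ≡⟨ cong (λ s → X s w) (+-comm t 1) ⟩
      U G (X t) w ≡⟨ all-fire⇒fixed (X t) (λ u → always u t T₀≤t) w ⟩
      X t w       ∎)
      where open ≡-Reasoning

lemma2p1 : ∀ {n} (G : Graph n) → Connected G →
    ∀ (σ : Position n) (p : ℕ) → Period G σ p → 1 < p →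
    ∃ λ T₀ → ∀ t → T₀ ≤ t → ∀ v → U^ G t σ v ≤ 2 * deg G v ∸ 1
lemma2p1 G connected σ p (0<p , (T₀ , periodic) , minimal) 1<p = T₀ , bounded
  where
    open Orbit G σ T₀ p 0<p periodic

    bounded : ∀ t → T₀ ≤ t → ∀ v → X t v ≤ 2 * deg G v ∸ 1
    bounded t T₀≤t v with X t v ≤? 2 * deg G v ∸ 1
    ... | yes ok = ok
    ... | no ¬ok = contradiction (minimal 1 (s≤s z≤n) period1) (<⇒≱ 1<p)
      where
        large : Large G (X t) v
        large = ≤-trans (m≤n+m∸n (2 * deg G v) 1) (≰⇒> ¬ok)
        period1 : IsEventualPeriod G σ 1
        period1 = everywhere⇒period1 λ w →
          alwaysFires-reach (connected v w) (large⇒alwaysFires t v T₀≤t large)
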